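{- For all formulas $A,B$ of $\mathrm{RLL}^{\bot}$ the following sequents are provable: $A^{\bot}\multimap B,\ A^{\bot}\otimes B^{\bot}\vdash B\otimes B^{\bot}$; $A^{\bot}\multimap B^{\bot},\ A^{\bot}\otimes B\vdash B\otimes B^{\bot}$; $A^{\bot}\multimap B,\ A^{\bot}\otimes A^{\bot}\vdash A^{\bot}\otimes B$; $A^{\bot}\multimap B^{\bot},\ A^{\bot}\otimes A^{\bot}\vdash A^{\bot}\otimes B^{\bot}$.
   Context: $\mathrm{RLL}^{\bot}$: formulas built from atomic formulas (including a distinguished atom $\bot$) by $\otimes$ and $\multimap$; sequents $\Gamma\vdash A$ with $\Gamma$ a finite multiset; rules exactly (Id) $A\vdash A$; ($\otimes$L) from $\Gamma,A,B\vdash C$ infer $\Gamma,A\otimes B\vdash C$; ($\otimes$R) from $\Gamma\vdash A$, $\Delta\vdash B$ infer $\Gamma,\Delta\vdash A\otimes B$; ($\multimap$L) from $\Gamma\vdash A$, $\Delta,B\vdash C$ infer $\Gamma,\Delta,A\multimap B\vdash C$; ($\multimap$R) from $\Gamma,A\vdash B$ infer $\Gamma\vdash A\multimap B$ (no cut, weakening, contraction). $A^{\bot}$ abbreviates $A\multimap\bot$. -}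

module Defs where

open import Data.Nat using (ℕ)
open import Data.List using (List; []; _∷_; _++_; [_])
open import Data.List.Relation.Binary.Permutation.Propositional using (_↭_)

infixr 6 _⊗_
infixr 5 _⊸_
data Formula : Set where
  atom : ℕ → Formula
  ⊥'   : Formula
  _⊗_  : Formula → Formula → Formula
  _⊸_  : Formula → Formula → Formula

_ᗮ : Formula → Formula
A ᗮ = A ⊸ ⊥'

-- Sequents Γ ⊢ A, Γ a finite multiset: represented by a list, where each rule's
-- conclusion context may be any permutation (_↭_) of the displayed one.
-- Thus derivability depends only on the multiset of Γ.
infix 3 _⊢_
data _⊢_ : List Formula → Formula → Set where
  id  : ∀ {Γ A} → Γ ↭ [ A ] → Γ ⊢ A
  ⊗L  : ∀ {Γ Γ' A B C} → Γ' ↭ ((A ⊗ B) ∷ Γ) → (A ∷ B ∷ Γ) ⊢ C → Γ' ⊢ C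
  ⊗R  : ∀ {Γ Δ Θ A B} → Θ ↭ (Γ ++ Δ) → Γ ⊢ A → Δ ⊢ B → Θ ⊢ A ⊗ B
  ⊸L  : ∀ {Γ Δ Θ A B C} → Θ ↭ ((A ⊸ B) ∷ Γ ++ Δ) → Γ ⊢ A → (B ∷ Δ) ⊢ C → Θ ⊢ C
  ⊸R  : ∀ {Γ A B} → (A ∷ Γ) ⊢ B → Γ ⊢ A ⊸ B

-- Each sequent is an instance of applying C ⊸ D to the left component of
-- C ⊗ E and re-pairing the result D with the leftover E, in either order.
module Submission where

open import Defs
open import Data.Product using (_×_; _,_)
open import Data.List using (List; []; _∷_)
open import Data.List.Relation.Binary.Permutation.Propositional using (_↭_; refl; prep; swap; trans)

axiom : ∀ {A} → A ∷ [] ⊢ A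
axiom = id refl

rotate : ∀ {x y z : Formula} → x ∷ y ∷ z ∷ [] ↭ z ∷ x ∷ y ∷ []
rotate {x} {y} {z} = trans (prep x (swap y z refl)) (swap x z refl)

exchange : ∀ {x y : Formula} → x ∷ y ∷ [] ↭ y ∷ x ∷ []
exchange {x} {y} = swap x y refl

⊸-apply-⊗-left : ∀ {C D E} → (C ⊸ D) ∷ (C ⊗ E) ∷ [] ⊢ D ⊗ E
⊸-apply-⊗-left = ⊗L exchange (⊸L rotate axiom (⊗R refl axiom axiom))

⊸-apply-⊗-right : ∀ {C D E} → (C ⊸ D) ∷ (C ⊗ E) ∷ [] ⊢ E ⊗ D
⊸-apply-⊗-right = ⊗L exchange (⊸L rotate axiom (⊗R exchange axiom axiom))

mainTheorem9 : ∀ (A B : Formula) →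
    ((A ᗮ ⊸ B) ∷ (A ᗮ ⊗ B ᗮ) ∷ [] ⊢ B ⊗ B ᗮ)
    × ((A ᗮ ⊸ B ᗮ) ∷ (A ᗮ ⊗ B) ∷ [] ⊢ B ⊗ B ᗮ)
    × ((A ᗮ ⊸ B) ∷ (A ᗮ ⊗ A ᗮ) ∷ [] ⊢ A ᗮ ⊗ B)
    × ((A ᗮ ⊸ B ᗮ) ∷ (A ᗮ ⊗ A ᗮ) ∷ [] ⊢ A ᗮ ⊗ B ᗮ)
mainTheorem9 A B =
  ⊸-apply-⊗-left , ⊸-apply-⊗-right , ⊸-apply-⊗-right , ⊸-apply-⊗-right
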